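{- Let $k$, $m$, $n$, $p$ and $r$ be positive integers and let $[\lambda_1,\ldots,\lambda_m]$ be a composition of $n+1$. Put $a_0=0$ and $a_i=\lambda_1+\cdots+\lambda_i$. Then $$W_{p,r}(n+k,n)=\sum_{k_1+\cdots+k_m=k}\prod_{i=1}^{m}W_{p,a_{i-1}p+r}(\lambda_i+k_i-1,\lambda_i-1),$$ the sum being over all $m$-tuples of nonnegative integers $(k_1,\ldots,k_m)$ with sum $k$.
   Context: For positive integers $p,r$ and an integer $N\ge0$, the $r$-Whitney numbers of the second kind $W_{p,r}(N,j)$, $0\le j\le N$, are defined by the polynomial identity in $x$: $(px+r)^N=\sum_{j=0}^{N}p^jW_{p,r}(N,j)(x)_j$, where $(x)_j=x(x-1)\cdots(x-j+1)$, $(x)_0=1$. A composition of $n+1$ is a sequence of positive integers summing to $n+1$. -}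

module Defs where

open import Data.Nat as ℕ using (ℕ; zero; suc; _∸_)
open import Data.Integer as ℤ using (ℤ; +_; _*_; _-_; _^_)
open import Data.Fin using (Fin; toℕ)
open import Data.Vec as Vec using (Vec; []; _∷_; lookup)
open import Data.List as List using (List; []; _∷_; map; foldr; filter; allFin; upTo; concatMap)
open import Data.Nat.ListAction as LA using ()
open import Data.Product using (_×_)
open import Relation.Binary.PropositionalEquality using (_≡_)

sumTo : ℕ → (ℕ → ℤ) → ℤ
sumTo zero    f = f 0
sumTo (suc N) f = sumTo N f ℤ.+ f (suc N)

falling : ℤ → ℕ → ℤ
falling x zero    = + 1
falling x (suc j) = falling x j * (x - + j)

-- W is a family of r-Whitney numbers of the second kind: for all positive
-- p, r, all N, and all x, (px+r)^N = Σ_{j=0}^N p^j W_{p,r}(N,j) (x)_j.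
-- (W p r N j stands for W_{p,r}(N,j).)  Since falling factorials form a
-- basis, this determines W p r N j uniquely for p,r ≥ 1 and j ≤ N.
IsWhitney : (ℕ → ℕ → ℕ → ℕ → ℤ) → Set
IsWhitney W = ∀ (p r N : ℕ) → 1 ℕ.≤ p → 1 ℕ.≤ r → ∀ (x : ℤ) →
  ((+ p) * x ℤ.+ (+ r)) ^ N ≡
  sumTo N (λ j → ((+ p) ^ j) * (W p r N j * falling x j))

boxVecs : (m k : ℕ) → List (Vec ℕ m)
boxVecs zero    k = Vec.[] ∷ []
boxVecs (suc m) k = concatMap (λ v → map (λ c → c Vec.∷ v) (upTo (suc k))) (boxVecs m k)

weakCompositions : (m k : ℕ) → List (Vec ℕ m)
weakCompositions m k = filter (λ v → Vec.sum v ℕ.≟ k) (boxVecs m k)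

sumℤ : List ℤ → ℤ
sumℤ = foldr ℤ._+_ (+ 0)

productℤ : List ℤ → ℤ
productℤ = foldr ℤ._*_ (+ 1)

-- a_i = λ_1 + ⋯ + λ_i (so a_0 = 0); for the 0-based index i : Fin m,
-- prefixSum λ i = λ_1 + ⋯ + λ_{i} in 1-based notation = a_{i-1} for the (i+1)-st part.
prefixSum : {m : ℕ} → Vec ℕ m → Fin m → ℕ
prefixSum lam i = LA.sum (List.take (toℕ i) (Vec.toList lam))

IsComposition : {m : ℕ} → Vec ℕ m → ℕ → Set
IsComposition lam N = (∀ i → 1 ℕ.≤ lookup lam i) × (Vec.sum lam ≡ N)

-- Multiplying the falling-factorial expansion of (px+r)^N by px + r and comparing coefficients
-- gives W(N+1,j) = W(N,j−1) + (jp+r) W(N,j), which identifies W_{p,r}(n+k,n) with the complete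
-- homogeneous symmetric polynomial h_k(r, p+r, …, np+r).  Cutting these n+1 arguments into
-- consecutive blocks of lengths λ₁, …, λ_m, the i-th block is exactly the argument list of
-- W_{p,a_{i−1}p+r}(λᵢ+kᵢ−1, λᵢ−1), and the identity is the convolution rule
-- h_k(X ++ Y) = Σ_{a+b=k} h_a(X) h_b(Y) iterated over the blocks.
module Submission where

open import Defs
open import Data.Nat using (ℕ; zero; suc; _+_; _*_; _∸_; _≤_; _<_; _≤′_; ≤′-refl; ≤′-step; z≤n; s≤s; z<s; _≟_; _≤?_)
import Data.Nat.Properties as ℕ
open import Data.Nat.Induction using (<-rec)
import Data.Nat.Tactic.RingSolver as ℕ-Solver
open import Data.Integer using (ℤ; +_; 0ℤ; 1ℤ)
  renaming (_+_ to _+ᶻ_; _*_ to _*ᶻ_; _-_ to _-ᶻ_; _^_ to _^ᶻ_)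
open import Data.Integer.Base using (≢-nonZero)
import Data.Integer.Properties as ℤ
open import Data.Integer.Tactic.RingSolver using (solve-∀)
open import Data.Fin as Fin using (Fin)
open import Data.Vec as Vec using (Vec; lookup; []; _∷_)
open import Data.List as List using (List; []; _∷_; _++_; map; allFin; concatMap; filter; upTo; applyUpTo)
import Data.List.Properties as List
open import Data.Sum using (inj₁; inj₂)
open import Data.Product using (_,_)
open import Function using (_∘_; id)
open import Relation.Nullary using (¬_; Dec; yes; no)
open import Relation.Nullary.Negation using (contradiction)
open import Relation.Binary using (tri<; tri≈; tri>)
open import Relation.Binary.PropositionalEquality
  using (_≡_; _≢_; refl; sym; trans; cong; cong₂; module ≡-Reasoning)
open import Algebra.Properties.CommutativeSemigroup ℤ.+-commutativeSemigroup
  using (interchange; xy∙z≈xz∙y)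

sumTo-cong : ∀ N {f g : ℕ → ℤ} → (∀ j → j ≤ N → f j ≡ g j) → sumTo N f ≡ sumTo N g
sumTo-cong zero    f≗g = f≗g 0 z≤n
sumTo-cong (suc N) f≗g =
  cong₂ _+ᶻ_ (sumTo-cong N (λ j j≤N → f≗g j (ℕ.m≤n⇒m≤1+n j≤N))) (f≗g (suc N) ℕ.≤-refl)

sumTo-zero : ∀ N {f : ℕ → ℤ} → (∀ j → j ≤ N → f j ≡ 0ℤ) → sumTo N f ≡ 0ℤ
sumTo-zero zero    f≡0 = f≡0 0 z≤n
sumTo-zero (suc N) f≡0 = cong₂ _+ᶻ_ (sumTo-zero N (λ j j≤N → f≡0 j (ℕ.m≤n⇒m≤1+n j≤N))) (f≡0 (suc N) ℕ.≤-refl)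

sumTo-distrib-+ : ∀ N (f g : ℕ → ℤ) → sumTo N (λ j → f j +ᶻ g j) ≡ sumTo N f +ᶻ sumTo N g
sumTo-distrib-+ zero    f g = refl
sumTo-distrib-+ (suc N) f g =
  trans (cong (_+ᶻ (f (suc N) +ᶻ g (suc N))) (sumTo-distrib-+ N f g))
        (interchange (sumTo N f) (sumTo N g) (f (suc N)) (g (suc N)))

sumTo-distrib-- : ∀ N (f g : ℕ → ℤ) → sumTo N (λ j → f j -ᶻ g j) ≡ sumTo N f -ᶻ sumTo N g
sumTo-distrib-- zero    f g = refl
sumTo-distrib-- (suc N) f g =
  trans (cong (_+ᶻ (f (suc N) -ᶻ g (suc N))) (sumTo-distrib-- N f g))
        (difference-interchange (sumTo N f) (sumTo N g) (f (suc N)) (g (suc N)))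
  where
  difference-interchange : ∀ a b c d → (a -ᶻ b) +ᶻ (c -ᶻ d) ≡ (a +ᶻ c) -ᶻ (b +ᶻ d)
  difference-interchange = solve-∀

sumTo-*ˡ : ∀ N a (f : ℕ → ℤ) → sumTo N (λ j → a *ᶻ f j) ≡ a *ᶻ sumTo N f
sumTo-*ˡ zero    a f = refl
sumTo-*ˡ (suc N) a f =
  trans (cong (_+ᶻ (a *ᶻ f (suc N))) (sumTo-*ˡ N a f)) (sym (ℤ.*-distribˡ-+ a _ _))

sumTo-suc : ∀ N (f : ℕ → ℤ) → sumTo (suc N) f ≡ f 0 +ᶻ sumTo N (f ∘ suc)
sumTo-suc zero    f = refl
sumTo-suc (suc N) f = trans (cong (_+ᶻ f (suc (suc N))) (sumTo-suc N f)) (ℤ.+-assoc (f 0) _ _)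

sumTo-single : ∀ N i (f : ℕ → ℤ) → i ≤ N → (∀ j → j ≤ N → j ≢ i → f j ≡ 0ℤ) → sumTo N f ≡ f i
sumTo-single N i f i≤N others≡0 with ℕ.m≤n⇒m<n∨m≡n i≤N
sumTo-single (suc N) i f _ others≡0 | inj₁ (s≤s i≤N) =
  trans (cong₂ _+ᶻ_ (sumTo-single N i f i≤N (λ j j≤N → others≡0 j (ℕ.m≤n⇒m≤1+n j≤N)))
                    (others≡0 (suc N) ℕ.≤-refl (ℕ.>⇒≢ (s≤s i≤N))))
        (ℤ.+-identityʳ (f i))
sumTo-single zero    .zero f _ others≡0 | inj₂ refl = refl
sumTo-single (suc N) .(suc N) f _ others≡0 | inj₂ refl =
  trans (cong (_+ᶻ f (suc N)) (sumTo-zero N (λ j j≤N → others≡0 j (ℕ.m≤n⇒m≤1+n j≤N) (ℕ.<⇒≢ (s≤s j≤N)))))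
        (ℤ.+-identityˡ (f (suc N)))

sumTo-vanishing-tail : ∀ {s K} (f : ℕ → ℤ) → s ≤ K → (∀ j → s < j → f j ≡ 0ℤ) → sumTo K f ≡ sumTo s f
sumTo-vanishing-tail {s} f s≤K tail≡0 = go (ℕ.≤⇒≤′ s≤K)
  where
  go : ∀ {K} → s ≤′ K → sumTo K f ≡ sumTo s f
  go ≤′-refl = refl
  go (≤′-step s≤′K) =
    trans (cong₂ _+ᶻ_ (go s≤′K) (tail≡0 _ (s≤s (ℕ.≤′⇒≤ s≤′K)))) (ℤ.+-identityʳ _)

falling-vanishes : ∀ {i j} → i < j → falling (+ i) j ≡ 0ℤ
falling-vanishes {i} {suc j} (s≤s i≤j) with ℕ.m≤n⇒m<n∨m≡n i≤j
... | inj₁ i<j  = cong (_*ᶻ (+ i -ᶻ + j)) (falling-vanishes i<j)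
... | inj₂ refl = trans (cong (falling (+ i) i *ᶻ_) (ℤ.+-inverseʳ (+ i))) (ℤ.*-zeroʳ (falling (+ i) i))

falling-nonzero : ∀ {i j} → j ≤ i → falling (+ i) j ≢ 0ℤ
falling-nonzero {i} {zero}  _   ()
falling-nonzero {i} {suc j} j<i e with ℤ.i*j≡0⇒i≡0∨j≡0 (falling (+ i) j) e
... | inj₁ e₁ = falling-nonzero (ℕ.<⇒≤ j<i) e₁
... | inj₂ e₂ = ℕ.<⇒≢ j<i (sym (ℤ.+-injective (ℤ.i-j≡0⇒i≡j (+ i) (+ j) e₂)))

-- Evaluating at x = i kills every (x)_j with j > i, so induction on i peels off e i.
falling-independent : ∀ N (e : ℕ → ℤ) → (∀ x → sumTo N (λ j → e j *ᶻ falling x j) ≡ 0ℤ) →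
                      ∀ i → i ≤ N → e i ≡ 0ℤ
falling-independent N e sum≡0 = <-rec (λ i → i ≤ N → e i ≡ 0ℤ) step
  where
  step : ∀ i → (∀ {j} → j < i → j ≤ N → e j ≡ 0ℤ) → i ≤ N → e i ≡ 0ℤ
  step i below i≤N with ℤ.i*j≡0⇒i≡0∨j≡0 (e i)
                          (trans (sym (sumTo-single N i _ i≤N others≡0)) (sum≡0 (+ i)))
    where
    others≡0 : ∀ j → j ≤ N → j ≢ i → e j *ᶻ falling (+ i) j ≡ 0ℤ
    others≡0 j j≤N j≢i with ℕ.<-cmp j i
    ... | tri< j<i _ _ = cong (_*ᶻ falling (+ i) j) (below j<i j≤N)
    ... | tri≈ _ j≡i _ = contradiction j≡i j≢i
    ... | tri> _ _ i<j = trans (cong (e j *ᶻ_) (falling-vanishes i<j)) (ℤ.*-zeroʳ (e j))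
  ... | inj₁ eᵢ≡0 = eᵢ≡0
  ... | inj₂ fall≡0 = contradiction fall≡0 (falling-nonzero {i} ℕ.≤-refl)

expansion : ℤ → ℕ → (ℕ → ℤ) → ℤ → ℤ
expansion q N c x = sumTo N (λ j → q ^ᶻ j *ᶻ (c j *ᶻ falling x j))

expansion-unique : ∀ {q} N (c d : ℕ → ℤ) → q ≢ 0ℤ →
                   (∀ x → expansion q N c x ≡ expansion q N d x) → ∀ i → i ≤ N → c i ≡ d i
expansion-unique {q} N c d q≢0 c≡d i i≤N =
  ℤ.*-cancelˡ-≡ (q ^ᶻ i) (c i) (d i) {{≢-nonZero (q≢0 ∘ ℤ.i^n≡0⇒i≡0 q i)}}
    (ℤ.i-j≡0⇒i≡j _ _ (falling-independent N e e-sum≡0 i i≤N))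
  where
  e : ℕ → ℤ
  e j = q ^ᶻ j *ᶻ c j -ᶻ q ^ᶻ j *ᶻ d j
  regroup : ∀ Q C D F → (Q *ᶻ C -ᶻ Q *ᶻ D) *ᶻ F ≡ Q *ᶻ (C *ᶻ F) -ᶻ Q *ᶻ (D *ᶻ F)
  regroup = solve-∀
  e-sum≡0 : ∀ x → sumTo N (λ j → e j *ᶻ falling x j) ≡ 0ℤ
  e-sum≡0 x = begin
    sumTo N (λ j → e j *ᶻ falling x j)
      ≡⟨ sumTo-cong N (λ j _ → regroup (q ^ᶻ j) (c j) (d j) (falling x j)) ⟩
    sumTo N (λ j → q ^ᶻ j *ᶻ (c j *ᶻ falling x j) -ᶻ q ^ᶻ j *ᶻ (d j *ᶻ falling x j))
      ≡⟨ sumTo-distrib-- N _ _ ⟩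
    expansion q N c x -ᶻ expansion q N d x
      ≡⟨ cong (_-ᶻ expansion q N d x) (c≡d x) ⟩
    expansion q N d x -ᶻ expansion q N d x
      ≡⟨ ℤ.+-inverseʳ (expansion q N d x) ⟩
    0ℤ ∎
    where open ≡-Reasoning

shiftUp : (ℕ → ℤ) → ℕ → ℤ
shiftUp c zero    = 0ℤ
shiftUp c (suc j) = c j

linear-*-expansion : ∀ q R N (c : ℕ → ℤ) → c (suc N) ≡ 0ℤ → ∀ x →
  (q *ᶻ x +ᶻ R) *ᶻ expansion q N c x ≡
  expansion q (suc N) (λ j → shiftUp c j +ᶻ (+ j *ᶻ q +ᶻ R) *ᶻ c j) x
linear-*-expansion q R N c c[N+1]≡0 x = begin
  (q *ᶻ x +ᶻ R) *ᶻ expansion q N c x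
    ≡⟨ sym (sumTo-*ˡ N (q *ᶻ x +ᶻ R) _) ⟩
  sumTo N (λ j → (q *ᶻ x +ᶻ R) *ᶻ (q ^ᶻ j *ᶻ (c j *ᶻ falling x j)))
    ≡⟨ sumTo-cong N (λ j _ → split q x R (q ^ᶻ j) (c j) (falling x j) (+ j)) ⟩
  sumTo N (λ j → raised j +ᶻ kept j)
    ≡⟨ sumTo-distrib-+ N raised kept ⟩
  sumTo N raised +ᶻ sumTo N kept
    ≡⟨ cong₂ _+ᶻ_ (sym raised-sum) (sym kept-sum) ⟩
  expansion q (suc N) (shiftUp c) x +ᶻ expansion q (suc N) d x
    ≡⟨ sym (sumTo-distrib-+ (suc N) _ _) ⟩
  sumTo (suc N) (λ j → q ^ᶻ j *ᶻ (shiftUp c j *ᶻ falling x j) +ᶻ q ^ᶻ j *ᶻ (d j *ᶻ falling x j))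
    ≡⟨ sumTo-cong (suc N) (λ j _ → sym (ℤ.*-distribˡ-+ (q ^ᶻ j) (shiftUp c j *ᶻ falling x j) (d j *ᶻ falling x j))) ⟩
  sumTo (suc N) (λ j → q ^ᶻ j *ᶻ (shiftUp c j *ᶻ falling x j +ᶻ d j *ᶻ falling x j))
    ≡⟨ sumTo-cong (suc N) (λ j _ → cong (q ^ᶻ j *ᶻ_) (sym (ℤ.*-distribʳ-+ (falling x j) (shiftUp c j) (d j)))) ⟩
  expansion q (suc N) (λ j → shiftUp c j +ᶻ d j) x ∎
  where
  open ≡-Reasoning
  d raised kept : ℕ → ℤ
  d j = (+ j *ᶻ q +ᶻ R) *ᶻ c j
  raised j = q ^ᶻ suc j *ᶻ (c j *ᶻ falling x (suc j))
  kept j = q ^ᶻ j *ᶻ (d j *ᶻ falling x j)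
  -- (qx + R) = q (x - j) + (jq + R), and (x)_j (x - j) = (x)_{j+1}.
  split : ∀ q x R Q C F J → (q *ᶻ x +ᶻ R) *ᶻ (Q *ᶻ (C *ᶻ F)) ≡
          (q *ᶻ Q) *ᶻ (C *ᶻ (F *ᶻ (x -ᶻ J))) +ᶻ Q *ᶻ (((J *ᶻ q +ᶻ R) *ᶻ C) *ᶻ F)
  split = solve-∀
  raised-sum : expansion q (suc N) (shiftUp c) x ≡ sumTo N raised
  raised-sum = trans (sumTo-suc N _) (ℤ.+-identityˡ (sumTo N raised))
  kept-sum : expansion q (suc N) d x ≡ sumTo N kept
  kept-sum = trans (cong (λ t → sumTo N kept +ᶻ q ^ᶻ suc N *ᶻ (((+ suc N *ᶻ q +ᶻ R) *ᶻ t) *ᶻ falling x (suc N)))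
                         c[N+1]≡0)
                   (trans (cong (sumTo N kept +ᶻ_) (annihilate (q ^ᶻ suc N) (+ suc N *ᶻ q +ᶻ R) (falling x (suc N))))
                          (ℤ.+-identityʳ (sumTo N kept)))
    where
    annihilate : ∀ Q A F → Q *ᶻ ((A *ᶻ 0ℤ) *ᶻ F) ≡ 0ℤ
    annihilate = solve-∀

restrict : ℕ → (ℕ → ℤ) → ℕ → ℤ
restrict N c j with j ≤? N
... | yes _ = c j
... | no _  = 0ℤ

restrict-≤ : ∀ {N j} (c : ℕ → ℤ) → j ≤ N → restrict N c j ≡ c j
restrict-≤ {N} {j} c j≤N with j ≤? N
... | yes _   = refl
... | no j≰N = contradiction j≤N j≰N

restrict-suc : ∀ N (c : ℕ → ℤ) → restrict N c (suc N) ≡ 0ℤ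
restrict-suc N c with suc N ≤? N
... | yes N<N = contradiction N<N (ℕ.n≮n N)
... | no _    = refl

complete : List ℤ → ℕ → ℤ
complete xs       zero    = 1ℤ
complete []       (suc k) = 0ℤ
complete (x ∷ xs) (suc k) = complete xs (suc k) +ᶻ x *ᶻ complete (x ∷ xs) k

progression : ℕ → ℕ → ℕ → List ℤ
progression r p zero    = []
progression r p (suc j) = + (j * p + r) ∷ progression r p j

module Whitney (W : ℕ → ℕ → ℕ → ℕ → ℤ) (isW : IsWhitney W) {p r : ℕ} (1≤p : 1 ≤ p) (1≤r : 1 ≤ r) where

  -- W p r N j is unconstrained for j > N; row N replaces those values by 0.
  row : ℕ → ℕ → ℤ
  row N = restrict N (W p r N)

  recurrence : ∀ N j → j ≤ suc N → W p r (suc N) j ≡ shiftUp (row N) j +ᶻ + (j * p + r) *ᶻ row N j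
  recurrence N = expansion-unique (suc N) _ _ p≢0 expand
    where
    open ≡-Reasoning
    p≢0 : + p ≢ 0ℤ
    p≢0 p≡0 = ℕ.<⇒≢ 1≤p (sym (ℤ.+-injective p≡0))
    expand : ∀ x → expansion (+ p) (suc N) (W p r (suc N)) x ≡
                   expansion (+ p) (suc N) (λ j → shiftUp (row N) j +ᶻ + (j * p + r) *ᶻ row N j) x
    expand x = begin
      expansion (+ p) (suc N) (W p r (suc N)) x
        ≡⟨ sym (isW p r (suc N) 1≤p 1≤r x) ⟩
      (+ p *ᶻ x +ᶻ + r) *ᶻ (+ p *ᶻ x +ᶻ + r) ^ᶻ N
        ≡⟨ cong ((+ p *ᶻ x +ᶻ + r) *ᶻ_) (isW p r N 1≤p 1≤r x) ⟩
      (+ p *ᶻ x +ᶻ + r) *ᶻ expansion (+ p) N (W p r N) x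
        ≡⟨ cong ((+ p *ᶻ x +ᶻ + r) *ᶻ_) (sumTo-cong N (λ j j≤N →
             cong (λ t → (+ p) ^ᶻ j *ᶻ (t *ᶻ falling x j)) (sym (restrict-≤ (W p r N) j≤N)))) ⟩
      (+ p *ᶻ x +ᶻ + r) *ᶻ expansion (+ p) N (row N) x
        ≡⟨ linear-*-expansion (+ p) (+ r) N (row N) (restrict-suc N (W p r N)) x ⟩
      expansion (+ p) (suc N) (λ j → shiftUp (row N) j +ᶻ (+ j *ᶻ + p +ᶻ + r) *ᶻ row N j) x
        ≡⟨ sumTo-cong (suc N) (λ j _ → cong (λ t → (+ p) ^ᶻ j *ᶻ ((shiftUp (row N) j +ᶻ t *ᶻ row N j) *ᶻ falling x j))
                                             (cong (_+ᶻ + r) (sym (ℤ.pos-* j p)))) ⟩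
      expansion (+ p) (suc N) (λ j → shiftUp (row N) j +ᶻ + (j * p + r) *ᶻ row N j) x ∎

  diagonal : ∀ N → W p r N N ≡ 1ℤ
  diagonal zero = sym (trans (isW p r 0 1≤p 1≤r 0ℤ) (trans (ℤ.*-identityˡ _) (ℤ.*-identityʳ _)))
  diagonal (suc N) = begin
    W p r (suc N) (suc N)
      ≡⟨ recurrence N (suc N) ℕ.≤-refl ⟩
    row N N +ᶻ + (suc N * p + r) *ᶻ row N (suc N)
      ≡⟨ cong₂ (λ a b → a +ᶻ + (suc N * p + r) *ᶻ b) (restrict-≤ (W p r N) ℕ.≤-refl) (restrict-suc N (W p r N)) ⟩
    W p r N N +ᶻ + (suc N * p + r) *ᶻ 0ℤ
      ≡⟨ trans (cong (W p r N N +ᶻ_) (ℤ.*-zeroʳ (+ (suc N * p + r)))) (ℤ.+-identityʳ (W p r N N)) ⟩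
    W p r N N
      ≡⟨ diagonal N ⟩
    1ℤ ∎
    where open ≡-Reasoning

  first-column : ∀ N → W p r (suc N) 0 ≡ + r *ᶻ W p r N 0
  first-column N = trans (recurrence N 0 z≤n)
                         (trans (ℤ.+-identityˡ (+ r *ᶻ row N 0)) (cong (+ r *ᶻ_) (restrict-≤ {N} (W p r N) z≤n)))

  pascal : ∀ N j → j < N → W p r (suc N) (suc j) ≡ W p r N j +ᶻ + (suc j * p + r) *ᶻ W p r N (suc j)
  pascal N j j<N = trans (recurrence N (suc j) (s≤s (ℕ.<⇒≤ j<N)))
    (cong₂ (λ a b → a +ᶻ + (suc j * p + r) *ᶻ b) (restrict-≤ (W p r N) (ℕ.<⇒≤ j<N)) (restrict-≤ (W p r N) j<N))

  whitney-complete : ∀ j k → W p r (j + k) j ≡ complete (progression r p (suc j)) k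
  whitney-complete j zero rewrite ℕ.+-identityʳ j = diagonal j
  whitney-complete zero (suc k) =
    trans (first-column k) (trans (cong (+ r *ᶻ_) (whitney-complete zero k)) (sym (ℤ.+-identityˡ _)))
  whitney-complete (suc j) (suc k) = trans (pascal (j + suc k) j (ℕ.m<m+n j z<s))
    (cong₂ (λ a b → a +ᶻ + (suc j * p + r) *ᶻ b)
           (whitney-complete j (suc k))
           (trans (cong (λ N → W p r N (suc j)) (ℕ.+-suc j k)) (whitney-complete (suc j) k)))

complete-[] : ∀ {k} → 0 < k → complete [] k ≡ 0ℤ
complete-[] {suc k} _ = refl

complete-++ : ∀ ys xs k → complete (ys ++ xs) k ≡ sumTo k (λ c → complete ys (k ∸ c) *ᶻ complete xs c)
complete-++ [] xs k = sym (trans (sumTo-single k k _ ℕ.≤-refl others≡0) diagonal-term)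
  where
  others≡0 : ∀ c → c ≤ k → c ≢ k → complete [] (k ∸ c) *ᶻ complete xs c ≡ 0ℤ
  others≡0 c c≤k c≢k = trans (cong (_*ᶻ complete xs c) (complete-[] (ℕ.m<n⇒0<n∸m (ℕ.≤∧≢⇒< c≤k c≢k))))
                             (ℤ.*-zeroˡ (complete xs c))
  diagonal-term : complete [] (k ∸ k) *ᶻ complete xs k ≡ complete xs k
  diagonal-term = trans (cong (λ t → complete [] t *ᶻ complete xs k) (ℕ.n∸n≡0 k)) (ℤ.*-identityˡ _)
complete-++ (y ∷ ys) xs zero    = refl
complete-++ (y ∷ ys) xs (suc k) = begin
  complete (ys ++ xs) (suc k) +ᶻ y *ᶻ complete (y ∷ ys ++ xs) k
    ≡⟨ cong₂ (λ a b → a +ᶻ y *ᶻ b) (complete-++ ys xs (suc k)) (complete-++ (y ∷ ys) xs k) ⟩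
  (A +ᶻ complete ys (k ∸ k) *ᶻ H) +ᶻ y *ᶻ B
    ≡⟨ xy∙z≈xz∙y A _ (y *ᶻ B) ⟩
  (A +ᶻ y *ᶻ B) +ᶻ complete ys (k ∸ k) *ᶻ H
    ≡⟨ cong₂ _+ᶻ_ merge (cong (_*ᶻ H) top) ⟩
  sumTo k (λ c → complete (y ∷ ys) (suc k ∸ c) *ᶻ complete xs c) +ᶻ complete (y ∷ ys) (k ∸ k) *ᶻ H ∎
  where
  open ≡-Reasoning
  A B H : ℤ
  A = sumTo k (λ c → complete ys (suc k ∸ c) *ᶻ complete xs c)
  B = sumTo k (λ c → complete (y ∷ ys) (k ∸ c) *ᶻ complete xs c)
  H = complete xs (suc k)
  top : complete ys (k ∸ k) ≡ complete (y ∷ ys) (k ∸ k)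
  top = trans (cong (complete ys) (ℕ.n∸n≡0 k)) (cong (complete (y ∷ ys)) (sym (ℕ.n∸n≡0 k)))
  recombine : ∀ c → c ≤ k →
    complete ys (suc k ∸ c) *ᶻ complete xs c +ᶻ y *ᶻ (complete (y ∷ ys) (k ∸ c) *ᶻ complete xs c) ≡
    complete (y ∷ ys) (suc k ∸ c) *ᶻ complete xs c
  recombine c c≤k rewrite ℕ.+-∸-assoc 1 c≤k =
    trans (cong (complete ys (suc (k ∸ c)) *ᶻ complete xs c +ᶻ_) (sym (ℤ.*-assoc y _ _)))
          (sym (ℤ.*-distribʳ-+ (complete xs c) (complete ys (suc (k ∸ c))) (y *ᶻ complete (y ∷ ys) (k ∸ c))))
  merge : A +ᶻ y *ᶻ B ≡ sumTo k (λ c → complete (y ∷ ys) (suc k ∸ c) *ᶻ complete xs c)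
  merge = begin
    A +ᶻ y *ᶻ B
      ≡⟨ cong (A +ᶻ_) (sym (sumTo-*ˡ k y _)) ⟩
    A +ᶻ sumTo k (λ c → y *ᶻ (complete (y ∷ ys) (k ∸ c) *ᶻ complete xs c))
      ≡⟨ sym (sumTo-distrib-+ k _ _) ⟩
    sumTo k (λ c → complete ys (suc k ∸ c) *ᶻ complete xs c +ᶻ y *ᶻ (complete (y ∷ ys) (k ∸ c) *ᶻ complete xs c))
      ≡⟨ sumTo-cong k recombine ⟩
    sumTo k (λ c → complete (y ∷ ys) (suc k ∸ c) *ᶻ complete xs c) ∎

[l+a]*p+r≡a*p+[l*p+r] : ∀ l a p r → (l + a) * p + r ≡ a * p + (l * p + r)
[l+a]*p+r≡a*p+[l*p+r] = ℕ-Solver.solve-∀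

progression-+ : ∀ r p l L → progression r p (l + L) ≡ progression (l * p + r) p L ++ progression r p l
progression-+ r p l zero    rewrite ℕ.+-identityʳ l = refl
progression-+ r p l (suc L) rewrite ℕ.+-suc l L =
  cong₂ _∷_ (cong +_ ([l+a]*p+r≡a*p+[l*p+r] l L p r)) (progression-+ r p l L)

_when_ : ∀ {A : Set} → ℤ → Dec A → ℤ
z when yes _ = z
z when no _  = 0ℤ

when-⇔ : ∀ {A B : Set} z (a? : Dec A) (b? : Dec B) → (A → B) → (B → A) → z when a? ≡ z when b?
when-⇔ z (yes _) (yes _)  _   _   = refl
when-⇔ z (no _)  (no _)   _   _   = refl
when-⇔ z (yes a) (no ¬b) a⇒b _   = contradiction (a⇒b a) ¬b
when-⇔ z (no ¬a) (yes b) _   b⇒a = contradiction (b⇒a b) ¬a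

when-no : ∀ {A : Set} z (a? : Dec A) → ¬ A → z when a? ≡ 0ℤ
when-no z (yes a) ¬a = contradiction a ¬a
when-no z (no _)  _  = refl

sumℤ-++ : ∀ xs ys → sumℤ (xs ++ ys) ≡ sumℤ xs +ᶻ sumℤ ys
sumℤ-++ []       ys = sym (ℤ.+-identityˡ (sumℤ ys))
sumℤ-++ (x ∷ xs) ys = trans (cong (x +ᶻ_) (sumℤ-++ xs ys)) (sym (ℤ.+-assoc x _ _))

sumℤ-map-zero : ∀ {A : Set} (f : A → ℤ) → (∀ x → f x ≡ 0ℤ) → ∀ xs → sumℤ (map f xs) ≡ 0ℤ
sumℤ-map-zero f f≡0 []       = refl
sumℤ-map-zero f f≡0 (x ∷ xs) = cong₂ _+ᶻ_ (f≡0 x) (sumℤ-map-zero f f≡0 xs)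

sumℤ-map-distrib-+ : ∀ {A : Set} (f g : A → ℤ) xs →
                     sumℤ (map (λ x → f x +ᶻ g x) xs) ≡ sumℤ (map f xs) +ᶻ sumℤ (map g xs)
sumℤ-map-distrib-+ f g []       = refl
sumℤ-map-distrib-+ f g (x ∷ xs) =
  trans (cong (f x +ᶻ g x +ᶻ_) (sumℤ-map-distrib-+ f g xs)) (interchange (f x) (g x) _ _)

sumℤ-concatMap : ∀ {A B : Set} (g : B → ℤ) (f : A → List B) xs →
                 sumℤ (map g (concatMap f xs)) ≡ sumℤ (map (λ x → sumℤ (map g (f x))) xs)
sumℤ-concatMap g f []       = refl
sumℤ-concatMap g f (x ∷ xs) = begin
  sumℤ (map g (f x ++ concatMap f xs))
    ≡⟨ cong sumℤ (List.map-++ g (f x) (concatMap f xs)) ⟩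
  sumℤ (map g (f x) ++ map g (concatMap f xs))
    ≡⟨ sumℤ-++ (map g (f x)) _ ⟩
  sumℤ (map g (f x)) +ᶻ sumℤ (map g (concatMap f xs))
    ≡⟨ cong (sumℤ (map g (f x)) +ᶻ_) (sumℤ-concatMap g f xs) ⟩
  sumℤ (map (λ x → sumℤ (map g (f x))) (x ∷ xs)) ∎
  where open ≡-Reasoning

sumℤ-comm : ∀ {A B : Set} (f : A → B → ℤ) xs ys →
            sumℤ (map (λ x → sumℤ (map (f x) ys)) xs) ≡ sumℤ (map (λ y → sumℤ (map (λ x → f x y) xs)) ys)
sumℤ-comm f []       ys = sym (sumℤ-map-zero (λ _ → 0ℤ) (λ _ → refl) ys)
sumℤ-comm f (x ∷ xs) ys =
  trans (cong (sumℤ (map (f x) ys) +ᶻ_) (sumℤ-comm f xs ys))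
        (sym (sumℤ-map-distrib-+ (f x) (λ y → sumℤ (map (λ x′ → f x′ y) xs)) ys))

sumℤ-applyUpTo : ∀ K (h : ℕ → ℕ) (f : ℕ → ℤ) → sumℤ (map f (applyUpTo h (suc K))) ≡ sumTo K (f ∘ h)
sumℤ-applyUpTo zero    h f = ℤ.+-identityʳ (f (h 0))
sumℤ-applyUpTo (suc K) h f =
  trans (cong (f (h 0) +ᶻ_) (sumℤ-applyUpTo K (h ∘ suc) f)) (sym (sumTo-suc K (f ∘ h)))

sumℤ-filter : ∀ {A : Set} {P : A → Set} (P? : ∀ x → Dec (P x)) (g : A → ℤ) xs →
              sumℤ (map g (filter P? xs)) ≡ sumℤ (map (λ x → g x when P? x) xs)
sumℤ-filter P? g []       = refl
sumℤ-filter P? g (x ∷ xs) with P? x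
... | yes _ = cong (g x +ᶻ_) (sumℤ-filter P? g xs)
... | no _  = trans (sumℤ-filter P? g xs) (sym (ℤ.+-identityˡ _))

compositionSum : ∀ m → ℕ → (Vec ℕ m → ℤ) → ℤ
compositionSum zero    zero    g = g []
compositionSum zero    (suc s) g = 0ℤ
compositionSum (suc m) s       g = sumTo s (λ c → compositionSum m (s ∸ c) (λ v → g (c ∷ v)))

compositionSum-cong : ∀ m s {g g′ : Vec ℕ m → ℤ} → (∀ v → g v ≡ g′ v) →
                      compositionSum m s g ≡ compositionSum m s g′
compositionSum-cong zero    zero    g≗g′ = g≗g′ []
compositionSum-cong zero    (suc s) g≗g′ = refl
compositionSum-cong (suc m) s       g≗g′ = sumTo-cong s (λ c _ → compositionSum-cong m (s ∸ c) (g≗g′ ∘ (c ∷_)))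

compositionSum-*ˡ : ∀ m s a (g : Vec ℕ m → ℤ) → compositionSum m s (λ v → a *ᶻ g v) ≡ a *ᶻ compositionSum m s g
compositionSum-*ˡ zero    zero    a g = refl
compositionSum-*ˡ zero    (suc s) a g = sym (ℤ.*-zeroʳ a)
compositionSum-*ˡ (suc m) s       a g =
  trans (sumTo-cong s (λ c _ → compositionSum-*ˡ m (s ∸ c) a (g ∘ (c ∷_))))
        (sumTo-*ˡ s a (λ c → compositionSum m (s ∸ c) (g ∘ (c ∷_))))

compositionSum-boxVecs : ∀ m {K s} (g : Vec ℕ m → ℤ) → s ≤ K →
  sumℤ (map (λ v → g v when (Vec.sum v ≟ s)) (boxVecs m K)) ≡ compositionSum m s g
compositionSum-boxVecs zero    {s = zero}  g _ = ℤ.+-identityʳ (g [])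
compositionSum-boxVecs zero    {s = suc s} g _ = refl
compositionSum-boxVecs (suc m) {K} {s} g s≤K = begin
  sumℤ (map φ (concatMap (λ v → map (_∷ v) (upTo (suc K))) (boxVecs m K)))
    ≡⟨ sumℤ-concatMap φ _ (boxVecs m K) ⟩
  sumℤ (map (λ v → sumℤ (map φ (map (_∷ v) (upTo (suc K))))) (boxVecs m K))
    ≡⟨ cong sumℤ (List.map-cong (λ v → cong sumℤ (sym (List.map-∘ {g = φ} {f = _∷ v} (upTo (suc K))))) (boxVecs m K)) ⟩
  sumℤ (map (λ v → sumℤ (map (λ c → φ (c ∷ v)) (upTo (suc K)))) (boxVecs m K))
    ≡⟨ sumℤ-comm (λ v c → φ (c ∷ v)) (boxVecs m K) (upTo (suc K)) ⟩
  sumℤ (map column (upTo (suc K)))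
    ≡⟨ sumℤ-applyUpTo K id column ⟩
  sumTo K column
    ≡⟨ sumTo-vanishing-tail column s≤K column-vanishes ⟩
  sumTo s column
    ≡⟨ sumTo-cong s column-reduces ⟩
  compositionSum (suc m) s g ∎
  where
  open ≡-Reasoning
  φ : Vec ℕ (suc m) → ℤ
  φ w = g w when (Vec.sum w ≟ s)
  column : ℕ → ℤ
  column c = sumℤ (map (λ v → φ (c ∷ v)) (boxVecs m K))
  column-vanishes : ∀ c → s < c → column c ≡ 0ℤ
  column-vanishes c s<c = sumℤ-map-zero (λ v → φ (c ∷ v))
    (λ v → when-no _ (c + Vec.sum v ≟ s) (λ e → ℕ.<⇒≱ s<c (ℕ.≤-trans (ℕ.m≤m+n c _) (ℕ.≤-reflexive e))))
    (boxVecs m K)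
  column-reduces : ∀ c → c ≤ s → column c ≡ compositionSum m (s ∸ c) (λ v → g (c ∷ v))
  column-reduces c c≤s =
    trans (cong sumℤ (List.map-cong (λ v → when-⇔ (g (c ∷ v)) (c + Vec.sum v ≟ s) (Vec.sum v ≟ s ∸ c)
                        (λ e → trans (sym (ℕ.m+n∸m≡n c _)) (cong (_∸ c) e))
                        (λ e → trans (cong (λ t → c + t) e) (ℕ.m+[n∸m]≡n c≤s)))
                      (boxVecs m K)))
          (compositionSum-boxVecs m (g ∘ (c ∷_)) (ℕ.≤-trans (ℕ.m∸n≤m s c) s≤K))

sum-weakCompositions : ∀ m k (g : Vec ℕ m → ℤ) → sumℤ (map g (weakCompositions m k)) ≡ compositionSum m k g
sum-weakCompositions m k g =
  trans (sumℤ-filter (λ v → Vec.sum v ≟ k) g (boxVecs m k)) (compositionSum-boxVecs m g ℕ.≤-refl)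

productℤ-allFin-suc : ∀ m (f : Fin (suc m) → ℤ) →
  productℤ (map f (allFin (suc m))) ≡ f Fin.zero *ᶻ productℤ (map (f ∘ Fin.suc) (allFin m))
productℤ-allFin-suc m f = cong (λ fs → f Fin.zero *ᶻ productℤ fs)
  (trans (List.map-tabulate Fin.suc f) (sym (List.map-tabulate id (f ∘ Fin.suc))))

-- The i-th factor is h_{kᵢ} of the i-th block of progression r p (λ₁ + ⋯ + λ_m).
partsProduct : ℕ → ℕ → ∀ {m} → Vec ℕ m → Vec ℕ m → ℤ
partsProduct p r {m} lam ks =
  productℤ (map (λ i → complete (progression (prefixSum lam i * p + r) p (lookup lam i)) (lookup ks i)) (allFin m))

partsProduct-∷ : ∀ p r {m} l (lam : Vec ℕ m) c ks →
  partsProduct p r (l ∷ lam) (c ∷ ks) ≡ complete (progression r p l) c *ᶻ partsProduct p (l * p + r) lam ks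
partsProduct-∷ p r {m} l lam c ks =
  trans (productℤ-allFin-suc m (λ i → complete (progression (prefixSum (l ∷ lam) i * p + r) p (lookup (l ∷ lam) i))
                                                (lookup (c ∷ ks) i)))
        (cong (λ fs → complete (progression r p l) c *ᶻ productℤ fs)
              (List.map-cong (λ i → cong (λ s → complete (progression s p (lookup lam i)) (lookup ks i))
                                         ([l+a]*p+r≡a*p+[l*p+r] l (prefixSum lam i) p r))
                             (allFin m)))

compositionSum-partsProduct : ∀ p r m (lam : Vec ℕ m) k →
  compositionSum m k (partsProduct p r lam) ≡ complete (progression r p (Vec.sum lam)) k
compositionSum-partsProduct p r zero    []        zero    = refl
compositionSum-partsProduct p r zero    []        (suc k) = refl
compositionSum-partsProduct p r (suc m) (l ∷ lam) k       = begin
  compositionSum (suc m) k (partsProduct p r (l ∷ lam))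
    ≡⟨ sumTo-cong k (λ c _ → trans (compositionSum-cong m (k ∸ c) (partsProduct-∷ p r l lam c))
                                   (compositionSum-*ˡ m (k ∸ c) (firstFactor c) (partsProduct p r′ lam))) ⟩
  sumTo k (λ c → firstFactor c *ᶻ compositionSum m (k ∸ c) (partsProduct p r′ lam))
    ≡⟨ sumTo-cong k (λ c _ → trans (cong (firstFactor c *ᶻ_) (compositionSum-partsProduct p r′ m lam (k ∸ c)))
                                   (ℤ.*-comm (firstFactor c) _)) ⟩
  sumTo k (λ c → complete (progression r′ p (Vec.sum lam)) (k ∸ c) *ᶻ firstFactor c)
    ≡⟨ sym (complete-++ (progression r′ p (Vec.sum lam)) (progression r p l) k) ⟩
  complete (progression r′ p (Vec.sum lam) ++ progression r p l) k
    ≡⟨ cong (λ xs → complete xs k) (sym (progression-+ r p l (Vec.sum lam))) ⟩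
  complete (progression r p (l + Vec.sum lam)) k ∎
  where
  open ≡-Reasoning
  r′ : ℕ
  r′ = l * p + r
  firstFactor : ℕ → ℤ
  firstFactor = complete (progression r p l)

corollary3p2 : (W : ℕ → ℕ → ℕ → ℕ → ℤ) → IsWhitney W →
    (k m n p r : ℕ) → 1 ≤ k → 1 ≤ m → 1 ≤ n → 1 ≤ p → 1 ≤ r →
    (lam : Vec ℕ m) → IsComposition lam (suc n) →
    W p r (n + k) n ≡
      sumℤ (map (λ ks → productℤ (map (λ i →
                  W p (prefixSum lam i * p + r)
                    (lookup lam i + lookup ks i ∸ 1) (lookup lam i ∸ 1))
                (allFin m)))
           (weakCompositions m k))
corollary3p2 W isW k m n p r _ _ _ 1≤p 1≤r lam (parts≥1 , sum≡n+1) = sym (begin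
  sumℤ (map summand (weakCompositions m k))
    ≡⟨ sum-weakCompositions m k summand ⟩
  compositionSum m k summand
    ≡⟨ compositionSum-cong m k (λ ks → cong productℤ (List.map-cong (factor ks) (allFin m))) ⟩
  compositionSum m k (partsProduct p r lam)
    ≡⟨ compositionSum-partsProduct p r m lam k ⟩
  complete (progression r p (Vec.sum lam)) k
    ≡⟨ cong (λ N → complete (progression r p N) k) sum≡n+1 ⟩
  complete (progression r p (suc n)) k
    ≡⟨ sym (Whitney.whitney-complete W isW 1≤p 1≤r n k) ⟩
  W p r (n + k) n ∎)
  where
  open ≡-Reasoning
  summand : Vec ℕ m → ℤ
  summand ks = productℤ (map (λ i → W p (prefixSum lam i * p + r)
                                     (lookup lam i + lookup ks i ∸ 1) (lookup lam i ∸ 1)) (allFin m))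
  factor : ∀ ks i → W p (prefixSum lam i * p + r) (lookup lam i + lookup ks i ∸ 1) (lookup lam i ∸ 1) ≡
                    complete (progression (prefixSum lam i * p + r) p (lookup lam i)) (lookup ks i)
  factor ks i with lookup lam i | parts≥1 i
  ... | suc l | _ = Whitney.whitney-complete W isW 1≤p (ℕ.≤-trans 1≤r (ℕ.m≤n+m r _)) l (lookup ks i)
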